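{- Let $m \ge 10^7$, let $M_3 = M_3(m) = 2^{10^{ -5}m}$ (rounded to an integer), and let $\phi$ be a red/blue coloring of the $3$-element subsets of $[0, M_3)$ with the following property: for every function $w\colon [0,M_3) \to [0,1]$ with $\sum_i w(i) = x \ge m$ and every color $c\in\{\mathrm{red},\mathrm{blue}\}$, one has $\sum_{\{i,j,k\}:\ \phi(\{i,j,k\}) = c} w(i)w(j)w(k) < 0.55\binom{x}{3}$. Define the coloring $\phi^{(3)}_m$ of $3$-element multisets from $[0,M_3)$ by $\phi^{(3)}_m(\{x_1,x_2,x_3\}) = \phi(\{x_1,x_2,x_3\})$ if $x_1,x_2,x_3$ are distinct and $\mathrm{red}$ otherwise. If $G$ is a $3$-graph with $G \in \mathcal{G}_m$ and $b = |V(G)|/m$, then there is no almost monochromatic embedding of $G$ into $\phi^{(3)}_m[b]$.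
   Context: For integers $a<b$, $[a,b) = \{a, a+1, \dots, b-1\}$. For real $x$, $\binom{x}{3} = x(x-1)(x-2)/6$. For disjoint vertex sets $X,Y,Z$ of a $3$-graph $G$, $e_G(X,Y,Z)$ denotes the number of edges of $G$ having exactly one vertex in each of $X$, $Y$, $Z$. With $s = 2^{10^{ -5}m}$ (rounded to an integer), $\mathcal{G}_m$ is the set of all $3$-graphs $G$ such that for every partition $V(G) = V_1\cup\dots\cup V_s$ (parts may be empty) with $|V_i| \le |V(G)|/m$ for all $i\in[s]$, $$\sum_{i<j<k:\ e_G(V_i,V_j,V_k)>0} |V_i||V_j||V_k| > 0.55\binom{|V(G)|}{3}.$$ Given $b>0$, a $3$-graph $G$ and a map $h\colon V(G)\to[0,M_3)$, $h$ is an embedding of $G$ into $\phi^{(3)}_m[b]$ if $|h^{ -1}(y)| \le b$ for all $y\in[0,M_3)$. It is an almost monochromatic embedding if additionally there is a color $c$ such that for every edge $\{v_1,v_2,v_3\}\in E(G)$, either $h(v_1),h(v_2),h(v_3)$ are not all distinct or $\phi^{(3)}_m(\{h(v_1),h(v_2),h(v_3)\}) = c$. -}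

module Defs where

open import Data.Nat as ℕ using (ℕ; zero; suc; _^_; _∸_)
open import Data.Integer using (+_)
open import Data.Rational as ℚ using (ℚ; 0ℚ; 1ℚ; _/_)
open import Data.Fin as Fin using (Fin; toℕ)
open import Data.Fin.Properties using (_<?_)
open import Data.List using (List; foldr; allFin)
open import Data.Bool using (Bool; true; false; if_then_else_; _∧_)
open import Data.Product using (Σ; _×_; _,_; ∃)
open import Data.Sum using (_⊎_)
open import Relation.Nullary using (¬_; Dec; yes; no)
open import Relation.Nullary.Decidable using (⌊_⌋)
open import Relation.Binary.PropositionalEquality using (_≡_; _≢_)

ℕtoℚ : ℕ → ℚ
ℕtoℚ n = + n / 1

binom3 : ℚ → ℚ
binom3 x = (x ℚ.* (x ℚ.- 1ℚ) ℚ.* (x ℚ.- ℚtwo)) ℚ.* (+ 1 / 6)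
  where ℚtwo = + 2 / 1

c055 : ℚ
c055 = + 11 / 20

sumℚ : ∀ {k} → (Fin k → ℚ) → ℚ
sumℚ {k} f = foldr (λ i acc → f i ℚ.+ acc) 0ℚ (allFin k)

sumℕ : ∀ {k} → (Fin k → ℕ) → ℕ
sumℕ {k} f = foldr (λ i acc → f i ℕ.+ acc) 0 (allFin k)

count : ∀ {k} → (Fin k → Bool) → ℕ
count f = sumℕ (λ i → if f i then 1 else 0)

incr3 : ∀ {k} → Fin k → Fin k → Fin k → Bool
incr3 i j k = ⌊ i <? j ⌋ ∧ ⌊ j <? k ⌋

sumIncr3 : ∀ {N} → (Fin N → Fin N → Fin N → ℚ) → ℚ
sumIncr3 f = sumℚ λ i → sumℚ λ j → sumℚ λ k → if incr3 i j k then f i j k else 0ℚ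

-- M3 rounding: N is 2^(m / 10^5) rounded to the nearest integer (halves up),
-- i.e.  N - 1/2 ≤ 2^(m/10^5) < N + 1/2, raised to the power 10^5 and scaled by 2^(10^5).
IsM3 : ℕ → ℕ → Set
IsM3 m N = ((2 ℕ.* N ∸ 1) ^ 100000 ℕ.≤ 2 ^ (m ℕ.+ 100000))
         × (2 ^ (m ℕ.+ 100000) ℕ.< (2 ℕ.* N ℕ.+ 1) ^ 100000)

data Colour : Set where
  red blue : Colour

Distinct3 : ∀ {N} → Fin N → Fin N → Fin N → Set
Distinct3 x y z = (x ≢ y) × (y ≢ z) × (x ≢ z)

-- a colouring of the 3-element subsets of [0,N): a function on triples that is
-- invariant under permuting its arguments (values on non-distinct triples irrelevant)
record Colouring3 (N : ℕ) : Set where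
  field
    col     : Fin N → Fin N → Fin N → Colour
    sym₁₂   : ∀ x y z → col x y z ≡ col y x z
    sym₂₃   : ∀ x y z → col x y z ≡ col x z y
open Colouring3 public

phi3 : ∀ {N} → Colouring3 N → Fin N → Fin N → Fin N → Colour
phi3 φ x y z with x Fin.≟ y | y Fin.≟ z | x Fin.≟ z
... | no _ | no _ | no _ = col φ x y z
... | _    | _    | _    = red

WeightProperty : ∀ {N} → ℕ → Colouring3 N → Set
WeightProperty {N} m φ =
  (w : Fin N → ℚ) → (∀ i → (0ℚ ℚ.≤ w i) × (w i ℚ.≤ 1ℚ)) →
  (x : ℚ) → sumℚ w ≡ x → ℕtoℚ m ℚ.≤ x →
  (c : Colour) →
  sumIncr3 (λ i j k → if isCol (col φ i j k) c then w i ℚ.* w j ℚ.* w k else 0ℚ)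
    ℚ.< c055 ℚ.* binom3 x
  where
  isCol : Colour → Colour → Bool
  isCol red red = true
  isCol blue blue = true
  isCol _ _ = false

record Graph3 : Set where
  field
    n       : ℕ
    edge    : Fin n → Fin n → Fin n → Bool
    esym₁₂  : ∀ x y z → edge x y z ≡ edge y x z
    esym₂₃  : ∀ x y z → edge x y z ≡ edge x z y
    edist   : ∀ x y z → edge x y z ≡ true → Distinct3 x y z
open Graph3 public

eG : (G : Graph3) → (Fin (n G) → Bool) → (Fin (n G) → Bool) → (Fin (n G) → Bool) → ℕ
eG G X Y Z = sumℕ λ u → sumℕ λ v → sumℕ λ w →
  if X u ∧ Y v ∧ Z w ∧ edge G u v w then 1 else 0

part : ∀ {n s} → (Fin n → Fin s) → Fin s → Fin n → Bool
part p i v = ⌊ p v Fin.≟ i ⌋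

InGm : ℕ → ℕ → Graph3 → Set
InGm m s G =
  (p : Fin (n G) → Fin s) →
  (∀ i → m ℕ.* count (part p i) ℕ.≤ n G) →
  c055 ℚ.* binom3 (ℕtoℚ (n G)) ℚ.<
    sumIncr3 (λ i j k →
      if ⌊ 0 ℕ.<? eG G (part p i) (part p j) (part p k) ⌋
      then ℕtoℚ (count (part p i) ℕ.* count (part p j) ℕ.* count (part p k))
      else 0ℚ)

-- b = |V(G)| / m as a rational (m = 0 never occurs in the statement)
bOf : ℕ → ℕ → ℚ
bOf n zero = 0ℚ
bOf n (suc k) = + n / suc k

IsEmbedding : ∀ {N} (G : Graph3) → ℚ → (Fin (n G) → Fin N) → Set
IsEmbedding {N} G b h = ∀ (y : Fin N) → ℕtoℚ (count (λ v → ⌊ h v Fin.≟ y ⌋)) ℚ.≤ b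

AlmostMono : ∀ {N} (G : Graph3) → Colouring3 N → (Fin (n G) → Fin N) → Set
AlmostMono G φ h = Σ Colour λ c → ∀ v₁ v₂ v₃ → edge G v₁ v₂ v₃ ≡ true →
  (¬ Distinct3 (h v₁) (h v₂) (h v₃)) ⊎ (phi3 φ (h v₁) (h v₂) (h v₃) ≡ c)

{-# OPTIONS --safe #-}
module Submission where

-- Let h be an embedding whose edges all get colour c (when their images are distinct), with fibres
-- V_y = h⁻¹(y) of size at most b = n/m.  Membership of G in 𝒢_m, applied to the partition into fibres,
-- gives 0.55·C(n,3) < Σ |V_i||V_j||V_k| over the triples i < j < k with an edge between V_i, V_j, V_k.
-- Each such triple is the image of an edge, so has colour c.  With the weights w(y) = |V_y|/b ∈ [0,1],
-- whose total is m, that sum is at most b³ times the c-coloured sum of w(i)w(j)w(k), which the hypothesis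
-- on φ bounds by b³·0.55·C(m,3) ≤ 0.55·C(n,3), since C(x,3)/x³ increases with x: a contradiction.

open import Algebra.Bundles using (CommutativeRing)
import Algebra.Properties.CommutativeMonoid.Sum as CommutativeMonoidSum
import Algebra.Properties.Semiring.Sum as SemiringSum
open import Data.Bool using (Bool; true; false; if_then_else_; _∧_)
open import Data.Empty using (⊥-elim)
open import Data.Fin as Fin using (Fin; zero; suc)
import Data.Fin.Properties as FinP
open import Data.Integer as ℤ using (+_)
import Data.Integer.Properties as ℤP
open import Data.List as List using (tabulate)
open import Data.Nat as ℕ using (ℕ; zero; suc; _≤_; _^_; z≤n; s≤s; NonZero)
import Data.Nat.Properties as ℕP
open import Data.Nat.Solver using () renaming (module +-*-Solver to ℕSolver)
open import Data.Product using (Σ; ∃; _×_; _,_)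
open import Data.Rational as ℚ using (ℚ; 0ℚ; 1ℚ; _/_; toℚᵘ)
import Data.Rational.Properties as ℚP
open import Data.Rational.Solver using () renaming (module +-*-Solver to ℚSolver)
import Data.Rational.Unnormalised as ℚᵘ
import Data.Rational.Unnormalised.Properties as ℚᵘP
open import Data.Sum using (_⊎_; inj₁; inj₂)
import Data.Vec.Functional as Vector
open import Function using (_∘_; case_of_)
open import Relation.Binary.PropositionalEquality
open import Relation.Nullary using (Dec; ¬_)
open import Relation.Nullary.Decidable using (⌊_⌋; yes; no; dec-true; isYes≗does)

open import Defs

module ℕΣ = CommutativeMonoidSum ℕP.+-0-commutativeMonoid
module ℚΣ = SemiringSum (CommutativeRing.semiring ℚP.+-*-commutativeRing)

toℚᵘ-/ : ∀ i d → toℚᵘ (i / suc d) ℚᵘ.≃ ℚᵘ.mkℚᵘ i d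
toℚᵘ-/ i d = ℚP.toℚᵘ-fromℚᵘ (ℚᵘ.mkℚᵘ i d)

ℕtoℚ-homo-+ : ∀ a b → ℕtoℚ (a ℕ.+ b) ≡ ℕtoℚ a ℚ.+ ℕtoℚ b
ℕtoℚ-homo-+ a b = ℚP.toℚᵘ-injective (begin-equality
  toℚᵘ (ℕtoℚ (a ℕ.+ b))                ≃⟨ toℚᵘ-/ (+ (a ℕ.+ b)) 0 ⟩
  ℚᵘ.mkℚᵘ (+ (a ℕ.+ b)) 0               ≃⟨ ℚᵘ.*≡* eq ⟩
  ℚᵘ.mkℚᵘ (+ a) 0 ℚᵘ.+ ℚᵘ.mkℚᵘ (+ b) 0  ≃⟨ ℚᵘP.+-cong (toℚᵘ-/ (+ a) 0) (toℚᵘ-/ (+ b) 0) ⟨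
  toℚᵘ (ℕtoℚ a) ℚᵘ.+ toℚᵘ (ℕtoℚ b)      ≃⟨ ℚP.toℚᵘ-homo-+ (ℕtoℚ a) (ℕtoℚ b) ⟨
  toℚᵘ (ℕtoℚ a ℚ.+ ℕtoℚ b)              ∎)
  where
  open ℚᵘP.≤-Reasoning
  eq : + (a ℕ.+ b) ℤ.* + 1 ≡ (+ a ℤ.* + 1 ℤ.+ + b ℤ.* + 1) ℤ.* + 1
  eq rewrite ℤP.*-identityʳ (+ a) | ℤP.*-identityʳ (+ b) = cong (ℤ._* + 1) (ℤP.pos-+ a b)

ℕtoℚ-homo-* : ∀ a b → ℕtoℚ (a ℕ.* b) ≡ ℕtoℚ a ℚ.* ℕtoℚ b
ℕtoℚ-homo-* a b = ℚP.toℚᵘ-injective (begin-equality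
  toℚᵘ (ℕtoℚ (a ℕ.* b))                ≃⟨ toℚᵘ-/ (+ (a ℕ.* b)) 0 ⟩
  ℚᵘ.mkℚᵘ (+ (a ℕ.* b)) 0               ≃⟨ ℚᵘ.*≡* (cong (ℤ._* + 1) (ℤP.pos-* a b)) ⟩
  ℚᵘ.mkℚᵘ (+ a) 0 ℚᵘ.* ℚᵘ.mkℚᵘ (+ b) 0  ≃⟨ ℚᵘP.*-cong (toℚᵘ-/ (+ a) 0) (toℚᵘ-/ (+ b) 0) ⟨
  toℚᵘ (ℕtoℚ a) ℚᵘ.* toℚᵘ (ℕtoℚ b)      ≃⟨ ℚP.toℚᵘ-homo-* (ℕtoℚ a) (ℕtoℚ b) ⟨
  toℚᵘ (ℕtoℚ a ℚ.* ℕtoℚ b)              ∎)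
  where open ℚᵘP.≤-Reasoning

ℕtoℚ-mono-≤ : ∀ {a b} → a ≤ b → ℕtoℚ a ℚ.≤ ℕtoℚ b
ℕtoℚ-mono-≤ {a} {b} a≤b = ℚP.toℚᵘ-cancel-≤ (begin
  toℚᵘ (ℕtoℚ a)    ≃⟨ toℚᵘ-/ (+ a) 0 ⟩
  ℚᵘ.mkℚᵘ (+ a) 0  ≤⟨ ℚᵘ.*≤* (ℤP.*-monoʳ-≤-nonNeg (+ 1) (ℤ.+≤+ a≤b)) ⟩
  ℚᵘ.mkℚᵘ (+ b) 0  ≃⟨ toℚᵘ-/ (+ b) 0 ⟨
  toℚᵘ (ℕtoℚ b)    ∎)
  where open ℚᵘP.≤-Reasoning

ℕtoℚ-cancel-≤ : ∀ {a b} → ℕtoℚ a ℚ.≤ ℕtoℚ b → a ≤ b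
ℕtoℚ-cancel-≤ {a} {b} le with ℚᵘP.≤-respʳ-≃ (toℚᵘ-/ (+ b) 0) (ℚᵘP.≤-respˡ-≃ (toℚᵘ-/ (+ a) 0) (ℚP.toℚᵘ-mono-≤ le))
... | ℚᵘ.*≤* a*1≤b*1 = ℤP.drop‿+≤+ (ℤP.*-cancelʳ-≤-pos (+ a) (+ b) (+ 1) a*1≤b*1)

ℕtoℚ-nonNeg : ∀ a → 0ℚ ℚ.≤ ℕtoℚ a
ℕtoℚ-nonNeg a = ℕtoℚ-mono-≤ (z≤n {a})

n/d*d≡n : ∀ n d .{{_ : NonZero d}} → (+ n / d) ℚ.* ℕtoℚ d ≡ ℕtoℚ n
n/d*d≡n n (suc k) = ℚP.toℚᵘ-injective (begin-equality
  toℚᵘ ((+ n / suc k) ℚ.* ℕtoℚ (suc k))              ≃⟨ ℚP.toℚᵘ-homo-* (+ n / suc k) (ℕtoℚ (suc k)) ⟩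
  toℚᵘ (+ n / suc k) ℚᵘ.* toℚᵘ (ℕtoℚ (suc k))        ≃⟨ ℚᵘP.*-cong (toℚᵘ-/ (+ n) k) (toℚᵘ-/ (+ suc k) 0) ⟩
  ℚᵘ.mkℚᵘ (+ n) k ℚᵘ.* ℚᵘ.mkℚᵘ (+ suc k) 0           ≃⟨ ℚᵘ.*≡* eq ⟩
  ℚᵘ.mkℚᵘ (+ n) 0                                     ≃⟨ toℚᵘ-/ (+ n) 0 ⟨
  toℚᵘ (ℕtoℚ n)                                       ∎)
  where
  open ℚᵘP.≤-Reasoning
  eq : (+ n ℤ.* + suc k) ℤ.* + 1 ≡ + n ℤ.* + (suc k ℕ.* 1)
  eq rewrite ℕP.*-identityʳ (suc k) = ℤP.*-identityʳ _

n/d*d/n≡1 : ∀ n d .{{_ : NonZero n}} .{{_ : NonZero d}} → (+ n / d) ℚ.* (+ d / n) ≡ 1ℚ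
n/d*d/n≡1 (suc a) (suc k) = ℚP.toℚᵘ-injective (begin-equality
  toℚᵘ ((+ suc a / suc k) ℚ.* (+ suc k / suc a))       ≃⟨ ℚP.toℚᵘ-homo-* (+ suc a / suc k) (+ suc k / suc a) ⟩
  toℚᵘ (+ suc a / suc k) ℚᵘ.* toℚᵘ (+ suc k / suc a)   ≃⟨ ℚᵘP.*-cong (toℚᵘ-/ (+ suc a) k) (toℚᵘ-/ (+ suc k) a) ⟩
  ℚᵘ.mkℚᵘ (+ suc a) k ℚᵘ.* ℚᵘ.mkℚᵘ (+ suc k) a         ≃⟨ ℚᵘ.*≡* eq ⟩
  toℚᵘ 1ℚ                                               ∎)
  where
  open ℚᵘP.≤-Reasoning
  eq : (+ suc a ℤ.* + suc k) ℤ.* + 1 ≡ + 1 ℤ.* + (suc k ℕ.* suc a)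
  eq rewrite ℤP.*-identityʳ (+ suc a ℤ.* + suc k) | ℤP.*-identityˡ (+ (suc k ℕ.* suc a))
           | ℤP.pos-* (suc a) (suc k) | ℕP.*-comm (suc k) (suc a) = refl

ℕtoℚ≤/⇒*≤ : ∀ {a n m} .{{_ : NonZero m}} → ℕtoℚ a ℚ.≤ + n / m → m ℕ.* a ≤ n
ℕtoℚ≤/⇒*≤ {a} {n} {m} a≤n/m = subst (_≤ n) (ℕP.*-comm a m) (ℕtoℚ-cancel-≤ (begin
  ℕtoℚ (a ℕ.* m)             ≡⟨ ℕtoℚ-homo-* a m ⟩
  ℕtoℚ a ℚ.* ℕtoℚ m          ≤⟨ ℚP.*-monoʳ-≤-nonNeg (ℕtoℚ m) {{ℚ.nonNegative (ℕtoℚ-nonNeg m)}} a≤n/m ⟩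
  (+ n / m) ℚ.* ℕtoℚ m       ≡⟨ n/d*d≡n n m ⟩
  ℕtoℚ n                     ∎))
  where open ℚP.≤-Reasoning

0≤* : ∀ {p q} → 0ℚ ℚ.≤ p → 0ℚ ℚ.≤ q → 0ℚ ℚ.≤ p ℚ.* q
0≤* {p} {q} 0≤p 0≤q =
  ℚP.nonNegative⁻¹ _ {{ℚP.nonNeg*nonNeg⇒nonNeg p {{ℚ.nonNegative 0≤p}} q {{ℚ.nonNegative 0≤q}}}}

0≤if : ∀ a {p} → 0ℚ ℚ.≤ p → 0ℚ ℚ.≤ (if a then p else 0ℚ)
0≤if true  0≤p = 0≤p
0≤if false _   = ℚP.≤-refl

ℕtoℚ-homo-*³ : ∀ a b c → ℕtoℚ (a ℕ.* b ℕ.* c) ≡ ℕtoℚ a ℚ.* ℕtoℚ b ℚ.* ℕtoℚ c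
ℕtoℚ-homo-*³ a b c = trans (ℕtoℚ-homo-* (a ℕ.* b) c) (cong (ℚ._* ℕtoℚ c) (ℕtoℚ-homo-* a b))

fall3 : ℕ → ℕ
fall3 n = n ℕ.* (n ℕ.∸ 1) ℕ.* (n ℕ.∸ 2)

binom3-ℕtoℚ : ∀ n → binom3 (ℕtoℚ n) ≡ ℕtoℚ (fall3 n) ℚ.* (+ 1 / 6)
binom3-ℕtoℚ 0 = refl
binom3-ℕtoℚ 1 = refl
binom3-ℕtoℚ (suc (suc a)) = begin
  binom3 (ℕtoℚ (2 ℕ.+ a))                                          ≡⟨ cong binom3 (ℕtoℚ-homo-+ 2 a) ⟩
  binom3 (ℕtoℚ 2 ℚ.+ A)                                            ≡⟨ expand A ⟩
  (ℕtoℚ 2 ℚ.+ A) ℚ.* (ℕtoℚ 1 ℚ.+ A) ℚ.* A ℚ.* sixth                ≡⟨ cong₂ (λ x y → x ℚ.* y ℚ.* A ℚ.* sixth) (ℕtoℚ-homo-+ 2 a) (ℕtoℚ-homo-+ 1 a) ⟨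
  ℕtoℚ (2 ℕ.+ a) ℚ.* ℕtoℚ (1 ℕ.+ a) ℚ.* A ℚ.* sixth                ≡⟨ cong (ℚ._* sixth) (ℕtoℚ-homo-*³ (2 ℕ.+ a) (1 ℕ.+ a) a) ⟨
  ℕtoℚ (fall3 (2 ℕ.+ a)) ℚ.* sixth                                 ∎
  where
  open ≡-Reasoning
  A = ℕtoℚ a
  sixth = + 1 / 6
  expand : ∀ X → binom3 (ℕtoℚ 2 ℚ.+ X) ≡ (ℕtoℚ 2 ℚ.+ X) ℚ.* (ℕtoℚ 1 ℚ.+ X) ℚ.* X ℚ.* sixth
  expand = solve 1 (λ X → ((two :+ X) :* ((two :+ X) :- con 1ℚ) :* ((two :+ X) :- two)) :* con sixth
                        := (two :+ X) :* (con (ℕtoℚ 1) :+ X) :* X :* con sixth) refl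
    where
    open ℚSolver
    two = con (ℕtoℚ 2)

n*[m∸k]≤m*[n∸k] : ∀ {m n} k → m ≤ n → n ℕ.* (m ℕ.∸ k) ≤ m ℕ.* (n ℕ.∸ k)
n*[m∸k]≤m*[n∸k] {m} {n} k m≤n = begin
  n ℕ.* (m ℕ.∸ k)          ≡⟨ ℕP.*-distribˡ-∸ n m k ⟩
  n ℕ.* m ℕ.∸ n ℕ.* k      ≤⟨ ℕP.∸-mono (ℕP.≤-reflexive (ℕP.*-comm n m)) (ℕP.*-monoˡ-≤ k m≤n) ⟩
  m ℕ.* n ℕ.∸ m ℕ.* k      ≡⟨ ℕP.*-distribˡ-∸ m n k ⟨
  m ℕ.* (n ℕ.∸ k)          ∎
  where open ℕP.≤-Reasoning

n³*fall3[m]≤m³*fall3[n] : ∀ {m n} → m ≤ n → n ℕ.* n ℕ.* n ℕ.* fall3 m ≤ m ℕ.* m ℕ.* m ℕ.* fall3 n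
n³*fall3[m]≤m³*fall3[n] {m} {n} m≤n = begin
  n ℕ.* n ℕ.* n ℕ.* fall3 m                              ≡⟨ regroup n m (m ℕ.∸ 1) (m ℕ.∸ 2) ⟩
  n ℕ.* m ℕ.* (n ℕ.* (m ℕ.∸ 1)) ℕ.* (n ℕ.* (m ℕ.∸ 2))    ≤⟨ ℕP.*-mono-≤ (ℕP.*-mono-≤ (ℕP.≤-reflexive (ℕP.*-comm n m))
                                                              (n*[m∸k]≤m*[n∸k] 1 m≤n)) (n*[m∸k]≤m*[n∸k] 2 m≤n) ⟩
  m ℕ.* n ℕ.* (m ℕ.* (n ℕ.∸ 1)) ℕ.* (m ℕ.* (n ℕ.∸ 2))    ≡⟨ regroup m n (n ℕ.∸ 1) (n ℕ.∸ 2) ⟨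
  m ℕ.* m ℕ.* m ℕ.* fall3 n                              ∎
  where
  open ℕP.≤-Reasoning
  regroup : ∀ a x y z → a ℕ.* a ℕ.* a ℕ.* (x ℕ.* y ℕ.* z) ≡ a ℕ.* x ℕ.* (a ℕ.* y) ℕ.* (a ℕ.* z)
  regroup = solve 4 (λ a x y z → a :* a :* a :* (x :* y :* z) := a :* x :* (a :* y) :* (a :* z)) refl
    where open ℕSolver

cube : ℚ → ℚ
cube x = x ℚ.* x ℚ.* x

[n/m]³*binom3[m]≤binom3[n] : ∀ {m n} .{{_ : NonZero m}} → m ≤ n →
  cube (+ n / m) ℚ.* binom3 (ℕtoℚ m) ℚ.≤ binom3 (ℕtoℚ n)
[n/m]³*binom3[m]≤binom3[n] {m} {n} m≤n = ℚP.*-cancelˡ-≤-pos (cube M) {{M³-pos}} (begin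
  cube M ℚ.* (cube b ℚ.* binom3 M)                    ≡⟨ pull (+ n / m) M (binom3 M) ⟩
  cube (b ℚ.* M) ℚ.* binom3 M                          ≡⟨ cong₂ (λ x y → cube x ℚ.* y) (n/d*d≡n n m) (binom3-ℕtoℚ m) ⟩
  cube (ℕtoℚ n) ℚ.* (ℕtoℚ (fall3 m) ℚ.* sixth)         ≡⟨ cube-scaled n (fall3 m) ⟩
  ℕtoℚ (n ℕ.* n ℕ.* n ℕ.* fall3 m) ℚ.* sixth           ≤⟨ ℚP.*-monoʳ-≤-nonNeg sixth (ℕtoℚ-mono-≤ (n³*fall3[m]≤m³*fall3[n] m≤n)) ⟩
  ℕtoℚ (m ℕ.* m ℕ.* m ℕ.* fall3 n) ℚ.* sixth           ≡⟨ cube-scaled m (fall3 n) ⟨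
  cube M ℚ.* (ℕtoℚ (fall3 n) ℚ.* sixth)                ≡⟨ cong (cube M ℚ.*_) (binom3-ℕtoℚ n) ⟨
  cube M ℚ.* binom3 (ℕtoℚ n)                           ∎)
  where
  open ℚP.≤-Reasoning
  M = ℕtoℚ m
  b = + n / m
  sixth = + 1 / 6
  M³-pos : ℚ.Positive (cube M)
  M³-pos = ℚP.pos*pos⇒pos (M ℚ.* M) {{ℚP.pos*pos⇒pos M M}} M
    where instance _ = ℚP.normalize-pos m 1
  pull : ∀ b M B → cube M ℚ.* (cube b ℚ.* B) ≡ cube (b ℚ.* M) ℚ.* B
  pull = solve 3 (λ b M B → M :* M :* M :* (b :* b :* b :* B) := (b :* M) :* (b :* M) :* (b :* M) :* B) refl
    where open ℚSolver
  cube-scaled : ∀ a x → cube (ℕtoℚ a) ℚ.* (ℕtoℚ x ℚ.* sixth) ≡ ℕtoℚ (a ℕ.* a ℕ.* a ℕ.* x) ℚ.* sixth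
  cube-scaled a x = trans (sym (ℚP.*-assoc (cube (ℕtoℚ a)) (ℕtoℚ x) sixth))
    (cong (ℚ._* sixth) (sym (trans (ℕtoℚ-homo-* (a ℕ.* a ℕ.* a) x) (cong (ℚ._* ℕtoℚ x) (ℕtoℚ-homo-*³ a a a)))))

foldr-tabulate : ∀ {A B C : Set} (_∙_ : B → C → C) (e : C) (f : A → B) {k} (g : Fin k → A) →
  List.foldr (λ a acc → f a ∙ acc) e (tabulate g) ≡ Vector.foldr _∙_ e (f ∘ g)
foldr-tabulate _∙_ e f {zero}  g = refl
foldr-tabulate _∙_ e f {suc k} g = cong (f (g zero) ∙_) (foldr-tabulate _∙_ e f (g ∘ suc))

sumℕ≡sum : ∀ {k} (f : Fin k → ℕ) → sumℕ f ≡ ℕΣ.sum f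
sumℕ≡sum f = foldr-tabulate ℕ._+_ 0 f (λ i → i)

sumℚ≡sum : ∀ {k} (f : Fin k → ℚ) → sumℚ f ≡ ℚΣ.sum f
sumℚ≡sum f = foldr-tabulate ℚ._+_ 0ℚ f (λ i → i)

sum-ones : ∀ k → ℕΣ.sum {k} (λ _ → 1) ≡ k
sum-ones zero    = refl
sum-ones (suc k) = cong suc (sum-ones k)

sum-indicator : ∀ {k} (x : Fin k) → ℕΣ.sum (λ y → if ⌊ x Fin.≟ y ⌋ then 1 else 0) ≡ 1
sum-indicator {suc k} zero    = cong suc (ℕΣ.sum-replicate-zero k)
sum-indicator {suc k} (suc x) = trans (ℕΣ.sum-cong-≗ indicator-suc) (sum-indicator x)
  where
  indicator-suc : ∀ y → (if ⌊ suc x Fin.≟ suc y ⌋ then 1 else 0) ≡ (if ⌊ x Fin.≟ y ⌋ then 1 else 0)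
  indicator-suc y with x Fin.≟ y
  ... | yes _ = refl
  ... | no _  = refl

term≤sum : ∀ {k} (f : Fin k → ℕ) i → f i ≤ ℕΣ.sum f
term≤sum f zero    = ℕP.m≤m+n (f zero) _
term≤sum f (suc i) = ℕP.≤-trans (term≤sum (f ∘ suc) i) (ℕP.m≤n+m _ (f zero))

sum-pos⇒term-pos : ∀ {k} (f : Fin k → ℕ) → 0 ℕ.< ℕΣ.sum f → ∃ λ i → 0 ℕ.< f i
sum-pos⇒term-pos {suc k} f sum>0 with f zero in eq
... | zero  = let i , fi>0 = sum-pos⇒term-pos (f ∘ suc) sum>0 in suc i , fi>0
... | suc _ = zero , subst (0 ℕ.<_) (sym eq) (s≤s z≤n)

sumℕ-pos⇒term-pos : ∀ {k} (f : Fin k → ℕ) → 0 ℕ.< sumℕ f → ∃ λ i → 0 ℕ.< f i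
sumℕ-pos⇒term-pos f pos = sum-pos⇒term-pos f (subst (0 ℕ.<_) (sumℕ≡sum f) pos)

sum-mono-scaled : ∀ {k} β (f g : Fin k → ℚ) → (∀ i → f i ℚ.≤ β ℚ.* g i) → ℚΣ.sum f ℚ.≤ β ℚ.* ℚΣ.sum g
sum-mono-scaled {zero}  β f g f≤βg = ℚP.≤-reflexive (sym (ℚP.*-zeroʳ β))
sum-mono-scaled {suc k} β f g f≤βg = begin
  f zero ℚ.+ ℚΣ.sum (f ∘ suc)                 ≤⟨ ℚP.+-mono-≤ (f≤βg zero) (sum-mono-scaled β (f ∘ suc) (g ∘ suc) (f≤βg ∘ suc)) ⟩
  β ℚ.* g zero ℚ.+ β ℚ.* ℚΣ.sum (g ∘ suc)     ≡⟨ ℚP.*-distribˡ-+ β (g zero) _ ⟨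
  β ℚ.* (g zero ℚ.+ ℚΣ.sum (g ∘ suc))         ∎
  where open ℚP.≤-Reasoning

ℕtoℚ-homo-sum : ∀ {k} (f : Fin k → ℕ) → ℚΣ.sum (ℕtoℚ ∘ f) ≡ ℕtoℚ (ℕΣ.sum f)
ℕtoℚ-homo-sum {zero}  f = refl
ℕtoℚ-homo-sum {suc k} f = trans (cong (ℕtoℚ (f zero) ℚ.+_) (ℕtoℚ-homo-sum (f ∘ suc))) (sym (ℕtoℚ-homo-+ (f zero) _))

sumℚ-mono-scaled : ∀ {k} β (f g : Fin k → ℚ) → (∀ i → f i ℚ.≤ β ℚ.* g i) → sumℚ f ℚ.≤ β ℚ.* sumℚ g
sumℚ-mono-scaled β f g f≤βg =
  subst₂ (λ x y → x ℚ.≤ β ℚ.* y) (sym (sumℚ≡sum f)) (sym (sumℚ≡sum g)) (sum-mono-scaled β f g f≤βg)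

sumIncr3-mono-scaled : ∀ {N} β (f g : Fin N → Fin N → Fin N → ℚ) →
  (∀ i j k → incr3 i j k ≡ true → f i j k ℚ.≤ β ℚ.* g i j k) → sumIncr3 f ℚ.≤ β ℚ.* sumIncr3 g
sumIncr3-mono-scaled β f g f≤βg =
  sumℚ-mono-scaled β _ _ λ i → sumℚ-mono-scaled β _ _ λ j → sumℚ-mono-scaled β _ _ λ k → pointwise i j k
  where
  pointwise : ∀ i j k → (if incr3 i j k then f i j k else 0ℚ) ℚ.≤ β ℚ.* (if incr3 i j k then g i j k else 0ℚ)
  pointwise i j k with incr3 i j k in eq
  ... | true  = f≤βg i j k eq
  ... | false = ℚP.≤-reflexive (sym (ℚP.*-zeroʳ β))

∧-≡-true : ∀ {a b} → a ∧ b ≡ true → a ≡ true × b ≡ true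
∧-≡-true {true} {true} _ = refl , refl

isYes-sound : ∀ {P : Set} (d : Dec P) → ⌊ d ⌋ ≡ true → P
isYes-sound (yes p) _ = p

isYes-complete : ∀ {P : Set} (d : Dec P) → P → ⌊ d ⌋ ≡ true
isYes-complete d p = trans (isYes≗does d) (dec-true d p)

indicator-pos : ∀ {a} → 0 ℕ.< (if a then 1 else 0) → a ≡ true
indicator-pos {true} _ = refl

fibreSize : ∀ {n s} → (Fin n → Fin s) → Fin s → ℕ
fibreSize h y = count (part h y)

sum-fibreSize : ∀ {n s} (h : Fin n → Fin s) → ℕΣ.sum (fibreSize h) ≡ n
sum-fibreSize {n} {s} h = begin
  ℕΣ.sum (fibreSize h)                    ≡⟨ ℕΣ.sum-cong-≗ (λ y → sumℕ≡sum (λ v → δ (h v) y)) ⟩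
  ℕΣ.sum (λ y → ℕΣ.sum λ v → δ (h v) y)  ≡⟨ ℕΣ.∑-comm (λ y v → δ (h v) y) ⟩
  ℕΣ.sum (λ v → ℕΣ.sum λ y → δ (h v) y)  ≡⟨ ℕΣ.sum-cong-≗ (sum-indicator ∘ h) ⟩
  ℕΣ.sum {n} (λ _ → 1)                    ≡⟨ sum-ones n ⟩
  n                                       ∎
  where
  open ≡-Reasoning
  δ : Fin s → Fin s → ℕ
  δ x y = if ⌊ x Fin.≟ y ⌋ then 1 else 0

fibreSize≤ : ∀ {n s} (h : Fin n → Fin s) y → fibreSize h y ≤ n
fibreSize≤ h y = subst (fibreSize h y ≤_) (sum-fibreSize h) (term≤sum (fibreSize h) y)

fibreSize-image : ∀ {n s} (h : Fin n → Fin s) v → 1 ≤ fibreSize h (h v)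
fibreSize-image h v = begin
  1                            ≡⟨ cong (λ a → if a then 1 else 0) (isYes-complete (h v Fin.≟ h v) refl) ⟨
  indicator v                  ≤⟨ term≤sum indicator v ⟩
  ℕΣ.sum indicator             ≡⟨ sumℕ≡sum indicator ⟨
  fibreSize h (h v)            ∎
  where
  open ℕP.≤-Reasoning
  indicator = λ u → if ⌊ h u Fin.≟ h v ⌋ then 1 else 0

fibres≤⇒m≤n : ∀ {m n s} (h : Fin n → Fin s) → (∀ y → m ℕ.* fibreSize h y ≤ n) → Fin n → m ≤ n
fibres≤⇒m≤n {m} {n} h fibres≤ v = begin
  m                             ≡⟨ ℕP.*-identityʳ m ⟨
  m ℕ.* 1                       ≤⟨ ℕP.*-monoʳ-≤ m (fibreSize-image h v) ⟩
  m ℕ.* fibreSize h (h v)       ≤⟨ fibres≤ (h v) ⟩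
  n                             ∎
  where open ℕP.≤-Reasoning

fibreWeight : ∀ {n s} .{{_ : NonZero n}} → ℕ → (Fin n → Fin s) → Fin s → ℚ
fibreWeight {n} m h y = ℕtoℚ (fibreSize h y) ℚ.* (+ m / n)

fibreWeight-nonNeg : ∀ {n s} .{{_ : NonZero n}} m (h : Fin n → Fin s) y → 0ℚ ℚ.≤ fibreWeight m h y
fibreWeight-nonNeg {n} m h y = 0≤* (ℕtoℚ-nonNeg (fibreSize h y)) (ℚP.nonNegative⁻¹ _ {{ℚP.normalize-nonNeg m n}})

fibreWeight≤1 : ∀ {n s} .{{_ : NonZero n}} m .{{_ : NonZero m}} (h : Fin n → Fin s) y →
  ℕtoℚ (fibreSize h y) ℚ.≤ + n / m → fibreWeight m h y ℚ.≤ 1ℚ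
fibreWeight≤1 {n} m h y fibre≤n/m = begin
  ℕtoℚ (fibreSize h y) ℚ.* (+ m / n)   ≤⟨ ℚP.*-monoʳ-≤-nonNeg (+ m / n) {{ℚP.normalize-nonNeg m n}} fibre≤n/m ⟩
  (+ n / m) ℚ.* (+ m / n)              ≡⟨ n/d*d/n≡1 n m ⟩
  1ℚ                                   ∎
  where open ℚP.≤-Reasoning

fibreSize≡scaled-fibreWeight : ∀ {n s} .{{_ : NonZero n}} m .{{_ : NonZero m}} (h : Fin n → Fin s) y →
  ℕtoℚ (fibreSize h y) ≡ (+ n / m) ℚ.* fibreWeight m h y
fibreSize≡scaled-fibreWeight {n} m h y = begin
  ℕtoℚ (fibreSize h y)                                ≡⟨ ℚP.*-identityʳ _ ⟨
  ℕtoℚ (fibreSize h y) ℚ.* 1ℚ                         ≡⟨ cong (ℕtoℚ (fibreSize h y) ℚ.*_) (n/d*d/n≡1 n m) ⟨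
  ℕtoℚ (fibreSize h y) ℚ.* ((+ n / m) ℚ.* (+ m / n))  ≡⟨ swap (ℕtoℚ (fibreSize h y)) (+ n / m) (+ m / n) ⟩
  (+ n / m) ℚ.* fibreWeight m h y                     ∎
  where
  open ≡-Reasoning
  swap : ∀ x b r → x ℚ.* (b ℚ.* r) ≡ b ℚ.* (x ℚ.* r)
  swap = solve 3 (λ x b r → x :* (b :* r) := b :* (x :* r)) refl
    where open ℚSolver

sum-fibreWeight : ∀ {n s} .{{_ : NonZero n}} m (h : Fin n → Fin s) → sumℚ (fibreWeight m h) ≡ ℕtoℚ m
sum-fibreWeight {n} m h = begin
  sumℚ (fibreWeight m h)                          ≡⟨ sumℚ≡sum (fibreWeight m h) ⟩
  ℚΣ.sum (fibreWeight m h)                        ≡⟨ ℚΣ.*-distribʳ-sum (+ m / n) (ℕtoℚ ∘ fibreSize h) ⟨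
  ℚΣ.sum (ℕtoℚ ∘ fibreSize h) ℚ.* (+ m / n)       ≡⟨ cong (ℚ._* (+ m / n)) (ℕtoℚ-homo-sum (fibreSize h)) ⟩
  ℕtoℚ (ℕΣ.sum (fibreSize h)) ℚ.* (+ m / n)       ≡⟨ cong (λ x → ℕtoℚ x ℚ.* (+ m / n)) (sum-fibreSize h) ⟩
  ℕtoℚ n ℚ.* (+ m / n)                            ≡⟨ ℚP.*-comm (ℕtoℚ n) (+ m / n) ⟩
  (+ m / n) ℚ.* ℕtoℚ n                            ≡⟨ n/d*d≡n m n ⟩
  ℕtoℚ m                                          ∎
  where open ≡-Reasoning

eG-pos⇒edge : ∀ (G : Graph3) X Y Z → 0 ℕ.< eG G X Y Z →
  ∃ λ u → ∃ λ v → ∃ λ w → X u ≡ true × Y v ≡ true × Z w ≡ true × edge G u v w ≡ true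
eG-pos⇒edge G X Y Z pos =
  let u , pos-u     = sumℕ-pos⇒term-pos _ pos
      v , pos-uv    = sumℕ-pos⇒term-pos _ pos-u
      w , pos-uvw   = sumℕ-pos⇒term-pos _ pos-uv
      Xu , YZe      = ∧-≡-true (indicator-pos pos-uvw)
      Yv , Ze       = ∧-≡-true YZe
      Zw , e        = ∧-≡-true Ze
  in u , v , w , Xu , Yv , Zw , e

incr3⇒distinct : ∀ {N} (i j k : Fin N) → incr3 i j k ≡ true → Distinct3 i j k
incr3⇒distinct i j k incr =
  let i<j? , j<k? = ∧-≡-true incr
      i<j = isYes-sound (i FinP.<? j) i<j?
      j<k = isYes-sound (j FinP.<? k) j<k?
  in FinP.<⇒≢ i<j , FinP.<⇒≢ j<k , FinP.<⇒≢ (FinP.<-trans i<j j<k)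

phi3-distinct : ∀ {N} (φ : Colouring3 N) {x y z} → Distinct3 x y z → phi3 φ x y z ≡ col φ x y z
phi3-distinct φ {x} {y} {z} (x≢y , y≢z , x≢z) with x Fin.≟ y | y Fin.≟ z | x Fin.≟ z
... | no _    | no _    | no _    = refl
... | yes x≡y | _       | _       = ⊥-elim (x≢y x≡y)
... | no _    | yes y≡z | _       = ⊥-elim (y≢z y≡z)
... | no _    | no _    | yes x≡z = ⊥-elim (x≢z x≡z)

AlmostMonoWith : ∀ {N} (G : Graph3) → Colouring3 N → (Fin (n G) → Fin N) → Colour → Set
AlmostMonoWith G φ h c = ∀ v₁ v₂ v₃ → edge G v₁ v₂ v₃ ≡ true →
  (¬ Distinct3 (h v₁) (h v₂) (h v₃)) ⊎ (phi3 φ (h v₁) (h v₂) (h v₃) ≡ c)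

monochromatic-triple : ∀ {N} (G : Graph3) (φ : Colouring3 N) (h : Fin (n G) → Fin N) {c} →
  AlmostMonoWith G φ h c → ∀ {u v w i j k} → edge G u v w ≡ true →
  h u ≡ i → h v ≡ j → h w ≡ k → Distinct3 i j k → col φ i j k ≡ c
monochromatic-triple G φ h mono {u} {v} {w} e refl refl refl distinct with mono u v w e
... | inj₁ ¬distinct = ⊥-elim (¬distinct distinct)
... | inj₂ phi3≡c    = trans (sym (phi3-distinct φ distinct)) phi3≡c

spanned-triple-colour : ∀ {N} (G : Graph3) (φ : Colouring3 N) (h : Fin (n G) → Fin N) {c} →
  AlmostMonoWith G φ h c → ∀ i j k → incr3 i j k ≡ true →
  0 ℕ.< eG G (part h i) (part h j) (part h k) → col φ i j k ≡ c
spanned-triple-colour G φ h mono i j k incr spanned =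
  let u , v , w , hu≡i , hv≡j , hw≡k , e = eG-pos⇒edge G (part h i) (part h j) (part h k) spanned
  in monochromatic-triple G φ h mono e (isYes-sound (h u Fin.≟ i) hu≡i) (isYes-sound (h v Fin.≟ j) hv≡j)
       (isYes-sound (h w Fin.≟ k) hw≡k) (incr3⇒distinct i j k incr)

spannedTerm : ∀ {s} (G : Graph3) → (Fin (n G) → Fin s) → Fin s → Fin s → Fin s → ℚ
spannedTerm G p i j k =
  if ⌊ 0 ℕ.<? eG G (part p i) (part p j) (part p k) ⌋
  then ℕtoℚ (fibreSize p i ℕ.* fibreSize p j ℕ.* fibreSize p k) else 0ℚ

spannedVolume : ∀ {s} (G : Graph3) → (Fin (n G) → Fin s) → ℚ
spannedVolume G p = sumIncr3 (spannedTerm G p)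

spannedVolume-empty : ∀ {s} (G : Graph3) (p : Fin (n G) → Fin s) → n G ≡ 0 → spannedVolume G p ℚ.≤ 0ℚ
spannedVolume-empty {s} G p n≡0 = ℚP.≤-trans
  (sumIncr3-mono-scaled 0ℚ (spannedTerm G p) (λ _ _ _ → 0ℚ) λ i j k _ → term≤0 i j k)
  (ℚP.≤-reflexive (ℚP.*-zeroˡ (sumIncr3 {s} λ _ _ _ → 0ℚ)))
  where
  term≤0 : ∀ i j k → (if ⌊ 0 ℕ.<? eG G (part p i) (part p j) (part p k) ⌋
    then ℕtoℚ (fibreSize p i ℕ.* fibreSize p j ℕ.* fibreSize p k) else 0ℚ) ℚ.≤ 0ℚ ℚ.* 0ℚ
  term≤0 i j k rewrite ℕP.n≤0⇒n≡0 (subst (fibreSize p i ≤_) n≡0 (fibreSize≤ p i))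
    with ⌊ 0 ℕ.<? eG G (part p i) (part p j) (part p k) ⌋
  ... | true  = ℚP.≤-refl
  ... | false = ℚP.≤-refl

spannedVolume≤weightedColourSum : ∀ {N} (G : Graph3) (φ : Colouring3 N) (h : Fin (n G) → Fin N) {c} →
  AlmostMonoWith G φ h c →
  (P : Fin N → Fin N → Fin N → Bool) → (∀ i j k → col φ i j k ≡ c → P i j k ≡ true) →
  (b : ℚ) (w : Fin N → ℚ) → 0ℚ ℚ.≤ b → (∀ y → 0ℚ ℚ.≤ w y) → (∀ y → ℕtoℚ (fibreSize h y) ≡ b ℚ.* w y) →
  spannedVolume G h ℚ.≤ cube b ℚ.* sumIncr3 (λ i j k → if P i j k then w i ℚ.* w j ℚ.* w k else 0ℚ)
spannedVolume≤weightedColourSum G φ h mono P selects b w 0≤b 0≤w fibre≡bw =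
  sumIncr3-mono-scaled (cube b) (spannedTerm G h) (λ i j k → if P i j k then w i ℚ.* w j ℚ.* w k else 0ℚ) term≤
  where
  0≤www : ∀ i j k → 0ℚ ℚ.≤ w i ℚ.* w j ℚ.* w k
  0≤www i j k = 0≤* (0≤* (0≤w i) (0≤w j)) (0≤w k)
  fibres≡ : ∀ i j k → ℕtoℚ (fibreSize h i ℕ.* fibreSize h j ℕ.* fibreSize h k) ≡ cube b ℚ.* (w i ℚ.* w j ℚ.* w k)
  fibres≡ i j k = begin
    ℕtoℚ (fibreSize h i ℕ.* fibreSize h j ℕ.* fibreSize h k)                  ≡⟨ ℕtoℚ-homo-*³ (fibreSize h i) _ _ ⟩
    ℕtoℚ (fibreSize h i) ℚ.* ℕtoℚ (fibreSize h j) ℚ.* ℕtoℚ (fibreSize h k)  ≡⟨ cong₂ ℚ._*_ (cong₂ ℚ._*_ (fibre≡bw i) (fibre≡bw j)) (fibre≡bw k) ⟩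
    b ℚ.* w i ℚ.* (b ℚ.* w j) ℚ.* (b ℚ.* w k)                                ≡⟨ regroup b (w i) (w j) (w k) ⟩
    cube b ℚ.* (w i ℚ.* w j ℚ.* w k)                                         ∎
    where
    open ≡-Reasoning
    regroup : ∀ b x y z → b ℚ.* x ℚ.* (b ℚ.* y) ℚ.* (b ℚ.* z) ≡ b ℚ.* b ℚ.* b ℚ.* (x ℚ.* y ℚ.* z)
    regroup = solve 4 (λ b x y z → b :* x :* (b :* y) :* (b :* z) := b :* b :* b :* (x :* y :* z)) refl
      where open ℚSolver
  term≤ : ∀ i j k → incr3 i j k ≡ true →
    (if ⌊ 0 ℕ.<? eG G (part h i) (part h j) (part h k) ⌋
     then ℕtoℚ (fibreSize h i ℕ.* fibreSize h j ℕ.* fibreSize h k) else 0ℚ)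
    ℚ.≤ cube b ℚ.* (if P i j k then w i ℚ.* w j ℚ.* w k else 0ℚ)
  term≤ i j k incr with ⌊ 0 ℕ.<? eG G (part h i) (part h j) (part h k) ⌋ in spanned
  ... | false = 0≤* (0≤* (0≤* 0≤b 0≤b) 0≤b) (0≤if (P i j k) (0≤www i j k))
  ... | true  = ℚP.≤-reflexive (trans (fibres≡ i j k)
    (cong (λ t → cube b ℚ.* (if t then w i ℚ.* w j ℚ.* w k else 0ℚ)) (sym P≡true)))
    where
    P≡true : P i j k ≡ true
    P≡true = selects i j k (spanned-triple-colour G φ h mono i j k incr
      (isYes-sound (0 ℕ.<? eG G (part h i) (part h j) (part h k)) spanned))

-- WeightProperty compares colours by a function local to its where-block, which cannot be named
-- here; the `_` is solved by unification with that comparison at the use in spannedVolume<binom3.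
WeightProperty-selects : ∀ {N} (m : ℕ) (φ : Colouring3 N) (c : Colour) i j k → col φ i j k ≡ c → _ ≡ true

spannedVolume<binom3 : ∀ {m N} .{{_ : NonZero m}} (φ : Colouring3 N) → WeightProperty m φ →
  (G : Graph3) .{{_ : NonZero (n G)}} (h : Fin (n G) → Fin N) {c : Colour} →
  (∀ y → ℕtoℚ (fibreSize h y) ℚ.≤ + n G / m) → AlmostMonoWith G φ h c →
  spannedVolume G h ℚ.< c055 ℚ.* binom3 (ℕtoℚ (n G))
spannedVolume<binom3 {m} φ wp G h {c} fibre≤b mono = ℚP.<-≤-trans
  (ℚP.≤-<-trans
    (spannedVolume≤weightedColourSum G φ h mono _ (WeightProperty-selects m φ c) b w 0≤b
      (fibreWeight-nonNeg m h) (fibreSize≡scaled-fibreWeight m h))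
    (ℚP.*-monoʳ-<-pos (cube b) {{b³-pos}}
      (wp w (λ y → fibreWeight-nonNeg m h y , fibreWeight≤1 m h y (fibre≤b y)) (ℕtoℚ m) (sum-fibreWeight m h) ℚP.≤-refl c)))
  (begin
    cube b ℚ.* (c055 ℚ.* binom3 (ℕtoℚ m))   ≡⟨ swap (cube b) c055 (binom3 (ℕtoℚ m)) ⟩
    c055 ℚ.* (cube b ℚ.* binom3 (ℕtoℚ m))   ≤⟨ ℚP.*-monoˡ-≤-nonNeg c055 ([n/m]³*binom3[m]≤binom3[n] m≤n) ⟩
    c055 ℚ.* binom3 (ℕtoℚ (n G))            ∎)
  where
  open ℚP.≤-Reasoning
  b = + n G / m
  w = fibreWeight m h
  instance
    b-pos : ℚ.Positive b
    b-pos = ℚP.normalize-pos (n G) m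
  b³-pos : ℚ.Positive (cube b)
  b³-pos = ℚP.pos*pos⇒pos (b ℚ.* b) {{ℚP.pos*pos⇒pos b b}} b
  0≤b : 0ℚ ℚ.≤ b
  0≤b = ℚP.<⇒≤ (ℚP.positive⁻¹ b)
  m≤n : m ≤ n G
  m≤n = fibres≤⇒m≤n h (λ y → ℕtoℚ≤/⇒*≤ (fibre≤b y)) (Fin.fromℕ< (ℕ.>-nonZero⁻¹ (n G)))
  swap : ∀ x y z → x ℚ.* (y ℚ.* z) ≡ y ℚ.* (x ℚ.* z)
  swap = solve 3 (λ x y z → x :* (y :* z) := y :* (x :* z)) refl
    where open ℚSolver

WeightProperty-selects m φ c i j k c≡ with col φ i j k
WeightProperty-selects m φ .red  i j k refl | red  = refl
WeightProperty-selects m φ .blue i j k refl | blue = refl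

lemma3p4 : (m : ℕ) → 10 ^ 7 ≤ m →
    (M3 : ℕ) → IsM3 m M3 →
    (φ : Colouring3 M3) → WeightProperty m φ →
    (G : Graph3) → InGm m M3 G →
    ¬ (Σ (Fin (n G) → Fin M3) λ h →
         IsEmbedding G (bOf (n G) m) h × AlmostMono G φ h)
lemma3p4 zero () _ _ _ _ _ _
lemma3p4 m@(suc _) _ _ _ φ wp G inG (h , embedded , c , mono) =
  ℚP.<-irrefl refl (ℚP.<-≤-trans (inG h (λ y → ℕtoℚ≤/⇒*≤ (embedded y))) volume-bound)
  where
  volume-bound : spannedVolume G h ℚ.≤ c055 ℚ.* binom3 (ℕtoℚ (n G))
  volume-bound = case n G ℕ.≟ 0 of λ where
    (yes n≡0) → subst (spannedVolume G h ℚ.≤_) (cong (λ x → c055 ℚ.* binom3 (ℕtoℚ x)) (sym n≡0))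
                  (spannedVolume-empty G h n≡0)
    (no n≢0)  → ℚP.<⇒≤ (spannedVolume<binom3 {m} φ wp G {{ℕ.≢-nonZero n≢0}} h embedded mono)
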